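{- Let $\mathbf{P}=(X,P)$ be a dually-CPT poset and let $M$ be a strong clique module of $\mathbf{P}$ such that $\mathbf{P}(M)$ is CI. If an element $z\in M$ is represented by a trivial path in a CPT representation of $\mathbf{P}$, then there exists a CPT representation of $\mathbf{P}$ in which $z$ is represented by a non-trivial path.
   Context: A CPT representation of a finite poset $\mathbf{P}=(X,P)$ is a tree $T$ with paths $W_x$ ($x\in X$) such that $x<y$ iff $W_x\subsetneq W_y$; $\mathbf{P}$ is CPT if one exists, CI if one exists with $T$ a path, and dually-CPT if $\mathbf{P}$ and its dual (reversed order) are CPT. A trivial path is a single vertex. A module is a set $M\subseteq X$ such that each $y\in X\setminus M$ is comparable to all or to none of the elements of $M$; it is strong if it overlaps no other module (for every module $M'$: $M\cap M'=\emptyset$, $M\subseteq M'$ or $M'\subseteq M$). A clique module is a non-trivial module ($|M|\ge 2$, $M\neq X$) whose induced subposet $\mathbf{P}(M)$ is a total order (any two elements comparable). -}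

module Defs where

open import Level using (0ℓ)
open import Data.Bool using (Bool; T)
open import Data.Nat using (ℕ; _≤_; _≥_)
open import Data.Fin using (Fin)
open import Data.Fin.Subset using (Subset; _∈_; _∉_; _⊆_)
open import Data.List using (List; []; _∷_; _++_; [_]; length)
open import Data.List.Membership.Propositional renaming (_∈_ to _∈ₗ_; _∉_ to _∉ₗ_)
open import Data.List.Relation.Unary.Unique.Propositional using (Unique)
open import Data.List.Relation.Unary.Linked using (Linked)
open import Data.Product using (Σ; _×_; ∃; ∃-syntax)
open import Data.Sum using (_⊎_)
open import Data.Empty using (⊥)
open import Relation.Nullary using (¬_)
open import Relation.Binary.PropositionalEquality using (_≡_)
open import Function using (flip)
open import Function.Bundles using (_⇔_)

record Tree (m : ℕ) : Set where
  field
    adj      : Fin m → Fin m → Bool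
  Adj : Fin m → Fin m → Set
  Adj u v = T (adj u v)
  field
    nonempty  : 1 ≤ m
    sym       : ∀ u v → Adj u v → Adj v u
    irrefl    : ∀ u → ¬ Adj u u
    connected : ∀ u v → u ≡ v ⊎ Σ (List (Fin m)) (λ ps → Linked Adj (u ∷ ps ++ [ v ]))
    acyclic   : ∀ a b c rest → Unique (a ∷ b ∷ c ∷ rest) →
                ¬ Linked Adj (a ∷ b ∷ c ∷ rest ++ [ a ])

record TPath {m : ℕ} (T' : Tree m) : Set where
  field
    verts    : List (Fin m)
    nonempty : 1 ≤ length verts
    unique   : Unique verts
    linked   : Linked (Tree.Adj T') verts

_∈P_ : ∀ {m} {T' : Tree m} → Fin m → TPath T' → Set
v ∈P p = v ∈ₗ TPath.verts p

_⊊P_ : ∀ {m} {T' : Tree m} → TPath T' → TPath T' → Set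
_⊊P_ {m} p q = (∀ v → v ∈P p → v ∈P q) × ∃[ v ] (v ∈P q × ¬ (v ∈P p))

Trivial NonTrivial : ∀ {m} {T' : Tree m} → TPath T' → Set
Trivial p = length (TPath.verts p) ≡ 1
NonTrivial p = 2 ≤ length (TPath.verts p)

-- the tree is itself a path: it has a Hamiltonian path
IsPathTree : ∀ {m} → Tree m → Set
IsPathTree {m} T' = Σ (List (Fin m)) λ vs →
  Unique vs × Linked (Tree.Adj T') vs × (∀ v → v ∈ₗ vs)

record CPTRep (X : Set) (_<_ : X → X → Set) : Set where
  field
    m    : ℕ
    tree : Tree m
    W    : X → TPath tree
    rep  : ∀ x y → (x < y) ⇔ (W x ⊊P W y)

CPT : (X : Set) → (X → X → Set) → Set
CPT X _<_ = CPTRep X _<_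

CI : (X : Set) → (X → X → Set) → Set
CI X _<_ = Σ (CPTRep X _<_) λ R → IsPathTree (CPTRep.tree R)

DuallyCPT : (X : Set) → (X → X → Set) → Set
DuallyCPT X _<_ = CPT X _<_ × CPT X (flip _<_)

module _ {n : ℕ} (_<_ : Fin n → Fin n → Set) where

  Comparable : Fin n → Fin n → Set
  Comparable x y = x ≡ y ⊎ x < y ⊎ y < x

  IsModule : Subset n → Set
  IsModule M = ∀ y → y ∉ M →
    (∀ x → x ∈ M → Comparable y x) ⊎ (∀ x → x ∈ M → ¬ Comparable y x)

  IsStrongModule : Subset n → Set
  IsStrongModule M = IsModule M × (∀ M' → IsModule M' →
    (∀ x → x ∈ M → x ∈ M' → ⊥) ⊎ M ⊆ M' ⊎ M' ⊆ M)

  IsCliqueModule : Subset n → Set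
  IsCliqueModule M = IsModule M
    × (∃[ x ] ∃[ y ] (x ∈ M × y ∈ M × ¬ x ≡ y))
    × (∃[ x ] x ∉ M)
    × (∀ x y → x ∈ M → y ∈ M → Comparable x y)

  Sub : Subset n → Set
  Sub M = Σ (Fin n) (_∈ M)

  restrict : (M : Subset n) → Sub M → Sub M → Set
  restrict M a b = Data.Product.proj₁ a < Data.Product.proj₁ b

-- Since W z is a single vertex v₀, no path lies properly inside it, so z is minimal. As M is a
-- chain with a second element, M has a least element a above z, and the interval {z} ∪ (z, a)
-- is a module meeting M; strongness of M puts it inside M, so nothing lies strictly between z
-- and a, and every y > z satisfies y ≥ a, i.e. W a ⊆ W y. Choose a neighbour v₁ of v₀ on W a,
-- subdivide the edge v₀v₁ by a new vertex, subdivide every path W x accordingly, and give z the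
-- path from v₀ to the new vertex. Subdivision preserves and reflects proper containment; the new
-- path of z lies properly inside the subdivision of W y exactly when W y contains v₀ and v₁,
-- i.e. when z < y; and an element x ≠ z with W x ⊆ {v₀} would be below a but incomparable to z,
-- which the clique module M forbids.

module Submission where

open import Defs
open import Level using (0ℓ)
open import Data.Bool using (Bool; T)
open import Data.Bool.Properties using (T?; T-≡)
open import Data.Empty using (⊥; ⊥-elim)
open import Data.Nat using (ℕ; zero; suc; _≤_; z≤n; s≤s)
import Data.Nat.Properties as ℕₚ
open import Data.Fin as Fin using (Fin; zero; suc; _≟_)
open import Data.Fin.Properties using (suc-injective)
open import Data.Fin.Subset using (Subset; _∈_)
open import Data.Fin.Subset.Properties using (_∈?_)
open import Data.Vec using (tabulate)
open import Data.Vec.Properties using (lookup∘tabulate; []=⇒lookup; lookup⇒[]=)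
open import Data.List using (List; []; _∷_; _++_; [_]; _∷ʳ_; length; map; allFin; initLast; _∷ʳ′_)
open import Data.List.Properties using (++-assoc; map-++; length-map; length-++-comm)
open import Data.List.Membership.Propositional using () renaming (_∈_ to _∈ₗ_; _∉_ to _∉ₗ_)
open import Data.List.Membership.Propositional.Properties using (∈-∃++; ∈-++⁺ʳ; ∈-allFin)
open import Data.List.Relation.Unary.Any using (here; there; any?)
open import Data.List.Relation.Unary.All as All using ([]; _∷_)
open import Data.List.Relation.Unary.All.Properties using (++⁺; ++⁻ˡ; ++⁻ʳ; ¬Any⇒All¬; All¬⇒¬Any)
open import Data.List.Relation.Unary.AllPairs using ([]; _∷_)
open import Data.List.Relation.Unary.Linked as Linked using (Linked; []; [-]; _∷_)
import Data.List.Relation.Unary.Linked.Properties as Linkedₚ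
open import Data.List.Relation.Unary.Unique.Propositional using (Unique)
import Data.List.Relation.Unary.Unique.Propositional.Properties as Uniqueₚ
import Data.List.Relation.Binary.Permutation.Setoid.Properties as Permutationₚ
import Data.Product as Product
open import Data.Product using (Σ; _×_; _,_; proj₁; proj₂; ∃-syntax)
open import Data.Sum using (_⊎_; inj₁; inj₂)
open import Relation.Nullary using (¬_; Dec; yes; no)
open import Relation.Nullary.Decidable using (_×-dec_; _⊎-dec_; ¬?; isYes; toWitness; fromWitness)
open import Relation.Unary using (Pred)
import Relation.Unary as U
open import Relation.Binary.Core using (Rel; _⇒_)
open import Relation.Binary.Definitions using (Decidable; Transitive)
open import Relation.Binary.Structures using (IsStrictPartialOrder)
open import Relation.Binary.Construct.Closure.ReflexiveTransitive using (Star; ε; _◅_; _◅◅_; gmap; kleisliStar)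
open import Relation.Binary.PropositionalEquality using (_≡_; _≢_; refl; sym; trans; subst; setoid)
open import Function using (_∘_; _on_; id)
open import Function.Bundles using (_⇔_; mk⇔; Equivalence)
import Function.Properties.Equivalence as ⇔

module _ {A : Set} {R : Rel A 0ℓ} where

  Linked-++⁻ : ∀ xs {y ys} → Linked R (xs ++ y ∷ ys) → Linked R (xs ∷ʳ y) × Linked R (y ∷ ys)
  Linked-++⁻ []            l       = [-] , l
  Linked-++⁻ (x ∷ [])      (r ∷ l) = r ∷ [-] , l
  Linked-++⁻ (x ∷ x′ ∷ xs) (r ∷ l) with Linked-++⁻ (x′ ∷ xs) l
  ... | l₁ , l₂ = r ∷ l₁ , l₂

  Linked-++⁺ : ∀ xs {y ys} → Linked R (xs ∷ʳ y) → Linked R (y ∷ ys) → Linked R (xs ++ y ∷ ys)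
  Linked-++⁺ []            _        l₂ = l₂
  Linked-++⁺ (x ∷ [])      (r ∷ _)  l₂ = r ∷ l₂
  Linked-++⁺ (x ∷ x′ ∷ xs) (r ∷ l₁) l₂ = r ∷ Linked-++⁺ (x′ ∷ xs) l₁ l₂

  Linked-∷ʳ⁺ : ∀ xs {x y} → Linked R (xs ∷ʳ x) → R x y → Linked R (xs ∷ʳ x ∷ʳ y)
  Linked-∷ʳ⁺ []            _       r = r ∷ [-]
  Linked-∷ʳ⁺ (_ ∷ [])      (s ∷ _) r = s ∷ r ∷ [-]
  Linked-∷ʳ⁺ (_ ∷ x′ ∷ xs) (s ∷ l) r = s ∷ Linked-∷ʳ⁺ (x′ ∷ xs) l r

  Linked-∷ʳ⁻ : ∀ xs {x y} → Linked R (xs ∷ʳ x ∷ʳ y) → Linked R (xs ∷ʳ x) × R x y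
  Linked-∷ʳ⁻ []            (r ∷ [-])     = [-] , r
  Linked-∷ʳ⁻ (_ ∷ [])      (s ∷ r ∷ [-]) = s ∷ [-] , r
  Linked-∷ʳ⁻ (_ ∷ x′ ∷ xs) (s ∷ l)       with Linked-∷ʳ⁻ (x′ ∷ xs) l
  ... | l′ , r = s ∷ l′ , r

  Star⇒walk : ∀ {x y} → Star R x y → x ≡ y ⊎ ∃[ ps ] Linked R (x ∷ ps ∷ʳ y)
  Star⇒walk ε       = inj₁ refl
  Star⇒walk (r ◅ s) with Star⇒walk s
  ... | inj₁ refl     = inj₂ ([] , r ∷ [-])
  ... | inj₂ (ps , l) = inj₂ (_ ∷ ps , r ∷ l)

  walk⇒Star : ∀ {x y} ps → Linked R (x ∷ ps ∷ʳ y) → Star R x y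
  walk⇒Star []       (r ∷ [-]) = r ◅ ε
  walk⇒Star (_ ∷ ps) (r ∷ l)   = r ◅ walk⇒Star ps l

module _ {A : Set} where

  Unique-++⁻ : ∀ (xs : List A) {y ys} → Unique (xs ++ y ∷ ys) → Unique (xs ∷ʳ y)
  Unique-++⁻ []       _       = [] ∷ []
  Unique-++⁻ (x ∷ xs) (a ∷ u) = ++⁺ (++⁻ˡ xs a) (All.head (++⁻ʳ xs a) ∷ []) ∷ Unique-++⁻ xs u

  length-∷ʳ-nonempty : ∀ (xs : List A) x → 1 ≤ length (xs ∷ʳ x)
  length-∷ʳ-nonempty []      _ = s≤s z≤n
  length-∷ʳ-nonempty (_ ∷ _) _ = s≤s z≤n

  distinct-members : ∀ {xs : List A} {v w} → v ∈ₗ xs → w ∈ₗ xs → v ≢ w → 2 ≤ length xs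
  distinct-members                  (here refl) (here refl) v≢w = ⊥-elim (v≢w refl)
  distinct-members {xs = _ ∷ _ ∷ _} _           _           _   = s≤s (s≤s z≤n)
  distinct-members {xs = _ ∷ []}    (here refl) (there ())
  distinct-members {xs = _ ∷ []}    (there ())  _

record IsCycle {A : Set} (R : Rel A 0ℓ) (x : A) (xs : List A) : Set where
  constructor cycle
  field
    long   : 2 ≤ length xs
    unique : Unique (x ∷ xs)
    closed : Linked R (x ∷ xs ∷ʳ x)

module _ {A : Set} {R : Rel A 0ℓ} where

  IsCycle-mono : ∀ {S : Rel A 0ℓ} {x xs} → R ⇒ S → IsCycle R x xs → IsCycle S x xs
  IsCycle-mono R⇒S (cycle long un cl) = cycle long un (Linked.map R⇒S cl)

  IsCycle-map⁻ : ∀ {B : Set} {f : B → A} {x xs} → IsCycle R (f x) (map f xs) → IsCycle (R on f) x xs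
  IsCycle-map⁻ {f = f} {x} {xs} (cycle long un cl) = cycle
    (subst (2 ≤_) (length-map f xs) long)
    (Uniqueₚ.map⁻ un)
    (Linkedₚ.map⁻ (subst (λ ys → Linked R (f x ∷ ys)) (sym (map-++ f xs [ x ])) cl))

  IsCycle-rotate : ∀ {x y} pre post → IsCycle R x (pre ++ y ∷ post) → IsCycle R y (post ++ x ∷ pre)
  IsCycle-rotate {x} {y} pre post (cycle long un cl) = cycle long′ un′ cl′
    where
    long′ : 2 ≤ length (post ++ x ∷ pre)
    long′ = subst (2 ≤_) (ℕₚ.suc-injective (length-++-comm (x ∷ pre) (y ∷ post))) long
    un′ : Unique (y ∷ post ++ x ∷ pre)
    un′ = Permutationₚ.Unique-resp-↭ (setoid A) (Permutationₚ.++-comm (setoid A) (x ∷ pre) (y ∷ post)) un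
    split : Linked R (x ∷ pre ∷ʳ y) × Linked R (y ∷ post ∷ʳ x)
    split = Linked-++⁻ (x ∷ pre) (subst (λ ys → Linked R (x ∷ ys)) (++-assoc pre (y ∷ post) [ x ]) cl)
    cl′ : Linked R (y ∷ (post ++ x ∷ pre) ∷ʳ y)
    cl′ = subst (λ ys → Linked R (y ∷ ys)) (sym (++-assoc post (x ∷ pre) [ y ]))
            (Linked-++⁺ (y ∷ post) (proj₂ split) (proj₁ split))

  IsCycle-through : ∀ {x xs y} → y ∈ₗ x ∷ xs → IsCycle R x xs → ∃[ ys ] IsCycle R y ys
  IsCycle-through (here refl) c = _ , c
  IsCycle-through (there y∈xs) c with ∈-∃++ y∈xs
  ... | pre , post , refl = post ++ _ ∷ pre , IsCycle-rotate pre post c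

module _ {m : ℕ} (T : Tree m) where
  open Tree T using (Adj; acyclic) renaming (sym to Adj-sym)

  tree-acyclic : ∀ {x xs} → ¬ IsCycle Adj x xs
  tree-acyclic {x} {b ∷ c ∷ rest} (cycle _ un cl) = acyclic x b c rest un cl
  tree-acyclic {xs = _ ∷ []} (cycle (s≤s ()) _ _)

  path-chordless : ∀ {x y r w} → Unique (x ∷ y ∷ r) → Linked Adj (x ∷ y ∷ r) → Adj x w → w ∉ₗ r
  path-chordless {x} {y} {w = w} un l a w∈r with ∈-∃++ w∈r
  ... | pre , post , refl = tree-acyclic (cycle (s≤s (length-∷ʳ-nonempty pre w))
    (Unique-++⁻ (x ∷ y ∷ pre) un)
    (Linked-∷ʳ⁺ (x ∷ y ∷ pre) (proj₁ (Linked-++⁻ (x ∷ y ∷ pre) l)) (Adj-sym x w a)))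

  next-on-path : ∀ {x y ys w} → Unique (x ∷ y ∷ ys) → Linked Adj (x ∷ y ∷ ys) →
                 Adj x w → w ∈ₗ y ∷ ys → w ≡ y
  next-on-path _  _ _ (here w≡y) = w≡y
  next-on-path un l a (there w∈) = ⊥-elim (path-chordless un l a w∈)

  neighbour-on-path : ∀ {l v} → Linked Adj l → 2 ≤ length l → v ∈ₗ l → ∃[ u ] Adj v u × u ∈ₗ l
  neighbour-on-path [-]             (s≤s ())
  neighbour-on-path (a ∷ _)         _ (here refl)         = _ , a , there (here refl)
  neighbour-on-path (a ∷ _)         _ (there (here refl)) = _ , Adj-sym _ _ a , here refl
  neighbour-on-path (_ ∷ [-])       _ (there (there ()))
  neighbour-on-path (_ ∷ l@(_ ∷ _)) _ (there v∈)          with neighbour-on-path l (s≤s (s≤s z≤n)) v∈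
  ... | u , a , u∈ = u , a , there u∈

_⊆P_ : ∀ {m} {T : Tree m} → TPath T → TPath T → Set
P ⊆P Q = ∀ v → v ∈P P → v ∈P Q

module _ {m : ℕ} {T : Tree m} where
  open TPath

  trivial-verts : ∀ {P : TPath T} → Trivial P → ∃[ v ] verts P ≡ [ v ]
  trivial-verts {P} triv with verts P | triv
  ... | v ∷ [] | _ = v , refl

  ⊆P-⊊P-trans : ∀ {P Q R : TPath T} → P ⊆P Q → Q ⊊P R → P ⊊P R
  ⊆P-⊊P-trans P⊆Q (Q⊆R , w , w∈R , w∉Q) = (λ v → Q⊆R v ∘ P⊆Q v) , w , w∈R , w∉Q ∘ P⊆Q w

  ⊊P⇒⊉P : ∀ {P Q : TPath T} → P ⊊P Q → ¬ Q ⊆P P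
  ⊊P⇒⊉P (_ , w , w∈Q , w∉P) Q⊆P = w∉P (Q⊆P w w∈Q)

  ∈-singleton : ∀ {P : TPath T} {v w} → verts P ≡ [ v ] → w ∈P P → w ≡ v
  ∈-singleton {P} {w = w} P≡ w∈P with subst (w ∈ₗ_) P≡ w∈P
  ... | here w≡v = w≡v

  some-vertex : (P : TPath T) → ∃[ v ] v ∈P P
  some-vertex P with verts P | nonempty P
  ... | v ∷ _ | _ = v , here refl

  ⊊P-trivial : ∀ {P Q : TPath T} → Trivial Q → ¬ P ⊊P Q
  ⊊P-trivial {P} {Q} triv (P⊆Q , w , w∈Q , w∉P) with trivial-verts {Q} triv | some-vertex P
  ... | v , Q≡ | h , h∈P = w∉P (subst (_∈P P) h≡w h∈P)
    where
    h≡w : h ≡ w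
    h≡w = trans (∈-singleton {Q} Q≡ (P⊆Q h h∈P)) (sym (∈-singleton {Q} Q≡ w∈Q))

  singleton-⊊P : ∀ {P Q : TPath T} {v w} → verts P ≡ [ v ] → v ∈P Q → w ∈P Q → w ≢ v → P ⊊P Q
  singleton-⊊P {P} {Q} P≡ v∈Q w∈Q w≢v =
    (λ u u∈P → subst (_∈P Q) (sym (∈-singleton {P} P≡ u∈P)) v∈Q) ,
    _ , w∈Q , w≢v ∘ ∈-singleton {P} P≡

  ⊊P⇒NonTrivial : ∀ {P Q : TPath T} → P ⊊P Q → NonTrivial Q
  ⊊P⇒NonTrivial {P} (P⊆Q , w , w∈Q , w∉P) with some-vertex P
  ... | h , h∈P = distinct-members (P⊆Q h h∈P) w∈Q λ { refl → w∉P h∈P }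

trivial-minimal : ∀ {X : Set} {_<_ : X → X → Set} (R : CPTRep X _<_) {z} →
                  Trivial (CPTRep.W R z) → ∀ x → ¬ x < z
trivial-minimal R {z} z-trivial x x<z =
  ⊊P-trivial {P = CPTRep.W R x} {Q = CPTRep.W R z} z-trivial (Equivalence.to (CPTRep.rep R x z) x<z)

-- Subdividing an edge

module Subdivision {m : ℕ} (T₀ : Tree m) {v₀ v₁ : Fin m} (e : Tree.Adj T₀ v₀ v₁) where
  open TPath
  open Tree T₀ using (Adj; adj; connected) renaming (sym to Adj-sym; irrefl to Adj-irrefl)

  End : Fin m → Set
  End x = x ≡ v₀ ⊎ x ≡ v₁

  Edge : Fin m → Fin m → Set
  Edge x y = (x ≡ v₀ × y ≡ v₁) ⊎ (x ≡ v₁ × y ≡ v₀)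

  Edge? : ∀ x y → Dec (Edge x y)
  Edge? x y = ((x ≟ v₀) ×-dec (y ≟ v₁)) ⊎-dec ((x ≟ v₁) ×-dec (y ≟ v₀))

  Adj⁻ : Rel (Fin m) 0ℓ
  Adj⁻ x y = Adj x y × ¬ Edge x y

  -- The new vertex is zero; the old vertex x becomes suc x.
  Adj⁺ : Rel (Fin (suc m)) 0ℓ
  Adj⁺ zero    zero    = ⊥
  Adj⁺ zero    (suc y) = End y
  Adj⁺ (suc x) zero    = End x
  Adj⁺ (suc x) (suc y) = Adj⁻ x y

  v₀≢v₁ : v₀ ≢ v₁
  v₀≢v₁ refl = Adj-irrefl v₀ e

  Edge-sym : ∀ {x y} → Edge x y → Edge y x
  Edge-sym (inj₁ (p , q)) = inj₂ (q , p)
  Edge-sym (inj₂ (p , q)) = inj₁ (q , p)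

  Edge⇒End : ∀ {x y} → Edge x y → End x × End y
  Edge⇒End (inj₁ (p , q)) = inj₁ p , inj₂ q
  Edge⇒End (inj₂ (p , q)) = inj₂ p , inj₁ q

  End⇒Edge : ∀ {x y} → End x → End y → x ≢ y → Edge x y
  End⇒Edge (inj₁ refl) (inj₁ refl) x≢y = ⊥-elim (x≢y refl)
  End⇒Edge (inj₁ p)    (inj₂ q)    _   = inj₁ (p , q)
  End⇒Edge (inj₂ p)    (inj₁ q)    _   = inj₂ (p , q)
  End⇒Edge (inj₂ refl) (inj₂ refl) x≢y = ⊥-elim (x≢y refl)

  Edge⇒Adj : ∀ {x y} → Edge x y → Adj x y
  Edge⇒Adj (inj₁ (refl , refl)) = e
  Edge⇒Adj (inj₂ (refl , refl)) = Adj-sym v₀ v₁ e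

  Adj⁺? : ∀ a b → Dec (Adj⁺ a b)
  Adj⁺? zero    zero    = no λ ()
  Adj⁺? zero    (suc y) = (y ≟ v₀) ⊎-dec (y ≟ v₁)
  Adj⁺? (suc x) zero    = (x ≟ v₀) ⊎-dec (x ≟ v₁)
  Adj⁺? (suc x) (suc y) = T? (adj x y) ×-dec ¬? (Edge? x y)

  Adj⁺-sym : ∀ a b → Adj⁺ a b → Adj⁺ b a
  Adj⁺-sym zero    (suc y) p        = p
  Adj⁺-sym (suc x) zero    p        = p
  Adj⁺-sym (suc x) (suc y) (a , ¬ex) = Adj-sym x y a , ¬ex ∘ Edge-sym

  Adj⁺-irrefl : ∀ a → ¬ Adj⁺ a a
  Adj⁺-irrefl (suc x) (a , _) = Adj-irrefl x a

  lift-edge : ∀ {x y} → Adj x y → Star Adj⁺ (suc x) (suc y)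
  lift-edge {x} {y} a with Edge? x y
  ... | yes ex = _◅_ {j = zero} (proj₁ (Edge⇒End ex)) (proj₂ (Edge⇒End ex) ◅ ε)
  ... | no ¬ex = (a , ¬ex) ◅ ε

  lift : ∀ {x y} → Star Adj x y → Star Adj⁺ (suc x) (suc y)
  lift = kleisliStar suc lift-edge

  connected₀ : ∀ x y → Star Adj x y
  connected₀ x y with connected x y
  ... | inj₁ refl     = ε
  ... | inj₂ (ps , l) = walk⇒Star ps l

  connected⁺ : ∀ a b → Star Adj⁺ a b
  connected⁺ zero    zero    = ε
  connected⁺ zero    (suc y) = inj₁ refl ◅ lift (connected₀ v₀ y)
  connected⁺ (suc x) zero    = lift (connected₀ x v₀) ◅◅ (inj₁ refl ◅ ε)
  connected⁺ (suc x) (suc y) = lift (connected₀ x y)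

  -- A path between the ends of v₀v₁ that avoids this edge would close a cycle with it.
  no-bypass : ∀ {y y′} ps → Unique (y ∷ ps ∷ʳ y′) → Linked Adj⁻ (y ∷ ps ∷ʳ y′) → ¬ Edge y y′
  no-bypass []                _  ((_ , ¬ex) ∷ [-]) ex = ¬ex ex
  no-bypass {y} {y′} (p ∷ ps) un l                 ex = tree-acyclic T₀
    (cycle (s≤s (length-∷ʳ-nonempty ps y′)) un
           (Linked-∷ʳ⁺ (y ∷ p ∷ ps) (Linked.map proj₁ l) (Edge⇒Adj (Edge-sym ex))))

  all-old : ∀ xs → zero ∉ₗ xs → Σ (List (Fin m)) λ ys → xs ≡ map Fin.suc ys
  all-old []           _    = [] , refl
  all-old (zero ∷ _)   0∉xs = ⊥-elim (0∉xs (here refl))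
  all-old (suc x ∷ xs) 0∉xs with all-old xs (0∉xs ∘ there)
  ... | ys , refl = x ∷ ys , refl

  no-cycle-through-new : ∀ {ws} → ¬ IsCycle Adj⁺ zero ws
  no-cycle-through-new {ws} c@(cycle _ (0∉ws ∷ _) _) with all-old ws (All¬⇒¬Any 0∉ws)
  ... | ys , refl = through-old ys c
    where
    through-old : ∀ ys → ¬ IsCycle Adj⁺ zero (map Fin.suc ys)
    through-old []       (cycle () _ _)
    through-old (y ∷ ys) c with initLast ys
    through-old (y ∷ _) (cycle (s≤s ()) _ _) | []
    through-old (y ∷ _) (cycle _ (_ ∷ un) cl) | ps ∷ʳ′ y′ =
      no-bypass ps un⁻ l⁻ (End⇒Edge End-y End-y′ y≢y′)
      where
      un⁻ : Unique (y ∷ ps ∷ʳ y′)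
      un⁻ = Uniqueₚ.map⁻ un
      y≢y′ : y ≢ y′
      y≢y′ refl = Uniqueₚ.Unique[x∷xs]⇒x∉xs un⁻ (∈-++⁺ʳ ps (here refl))
      cl′ : Linked Adj⁺ (zero ∷ (map Fin.suc (y ∷ ps) ∷ʳ suc y′) ∷ʳ zero)
      cl′ = subst (λ zs → Linked Adj⁺ (zero ∷ suc y ∷ zs ∷ʳ zero)) (map-++ Fin.suc ps [ y′ ]) cl
      split : Linked Adj⁺ (zero ∷ map Fin.suc (y ∷ ps) ∷ʳ suc y′) × End y′
      split = Linked-∷ʳ⁻ (zero ∷ map Fin.suc (y ∷ ps)) cl′
      End-y : End y
      End-y with cl′
      ... | p ∷ _ = p
      End-y′ : End y′
      End-y′ = proj₂ split
      l⁻ : Linked Adj⁻ (y ∷ ps ∷ʳ y′)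
      l⁻ with proj₁ split
      ... | _ ∷ l = Linkedₚ.map⁻ (subst (Linked Adj⁺) (sym (map-++ Fin.suc (y ∷ ps) [ y′ ])) l)

  acyclic⁺ : ∀ {x xs} → ¬ IsCycle Adj⁺ x xs
  acyclic⁺ {x} {xs} c with any? (zero ≟_) (x ∷ xs)
  ... | yes 0∈ = no-cycle-through-new (proj₂ (IsCycle-through 0∈ c))
  acyclic⁺ {zero}      c | no 0∉ = 0∉ (here refl)
  acyclic⁺ {suc x} {xs} c | no 0∉ with all-old xs (0∉ ∘ there)
  ... | ys , refl = tree-acyclic T₀ (IsCycle-mono proj₁ (IsCycle-map⁻ {f = Fin.suc} c))

  adj⁺ : Fin (suc m) → Fin (suc m) → Bool
  adj⁺ a b = isYes (Adj⁺? a b)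

  from-adj⁺ : ∀ {a b} → T (adj⁺ a b) → Adj⁺ a b
  from-adj⁺ {a} {b} = toWitness {a? = Adj⁺? a b}

  to-adj⁺ : ∀ {a b} → Adj⁺ a b → T (adj⁺ a b)
  to-adj⁺ {a} {b} = fromWitness {a? = Adj⁺? a b}

  subdivided : Tree (suc m)
  subdivided = record
    { adj       = adj⁺
    ; nonempty  = s≤s z≤n
    ; sym       = λ a b p → to-adj⁺ (Adj⁺-sym a b (from-adj⁺ p))
    ; irrefl    = λ a p → Adj⁺-irrefl a (from-adj⁺ p)
    ; connected = λ a b → Star⇒walk (gmap id to-adj⁺ (connected⁺ a b))
    ; acyclic   = λ a b c rest un l → acyclic⁺ (cycle (s≤s (s≤s z≤n)) un (Linked.map from-adj⁺ l))
    }

  subdivideFrom : Fin m → List (Fin m) → List (Fin (suc m))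
  subdivideFrom x []       = []
  subdivideFrom x (y ∷ ys) with Edge? x y
  ... | yes _ = zero ∷ suc y ∷ subdivideFrom y ys
  ... | no  _ = suc y ∷ subdivideFrom y ys

  subdivide : List (Fin m) → List (Fin (suc m))
  subdivide []       = []
  subdivide (x ∷ xs) = suc x ∷ subdivideFrom x xs

  ∈-subdivide⁺ : ∀ xs {w} → w ∈ₗ xs → suc w ∈ₗ subdivide xs
  ∈-subdivide⁺ (x ∷ _)      (here refl) = here refl
  ∈-subdivide⁺ (x ∷ y ∷ ys) (there w∈)  with Edge? x y
  ... | yes _ = there (there (∈-subdivide⁺ (y ∷ ys) w∈))
  ... | no  _ = there (∈-subdivide⁺ (y ∷ ys) w∈)

  ∈-subdivide⁻ : ∀ xs {w} → suc w ∈ₗ subdivide xs → w ∈ₗ xs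
  ∈-subdivide⁻ (x ∷ _)      (here eq) = here (suc-injective eq)
  ∈-subdivide⁻ (x ∷ y ∷ ys) (there p) with Edge? x y | p
  ... | yes _ | there q = there (∈-subdivide⁻ (y ∷ ys) q)
  ... | no  _ | q       = there (∈-subdivide⁻ (y ∷ ys) q)

  new-∈-subdivide⁻ : ∀ xs → zero ∈ₗ subdivide xs → v₀ ∈ₗ xs × v₁ ∈ₗ xs
  new-∈-subdivide⁻ (x ∷ y ∷ ys) (there p) with Edge? x y | p
  ... | yes (inj₁ (refl , refl)) | here refl = here refl , there (here refl)
  ... | yes (inj₂ (refl , refl)) | here refl = there (here refl) , here refl
  ... | yes _ | there q = Product.map there there (new-∈-subdivide⁻ (y ∷ ys) q)
  ... | no  _ | q       = Product.map there there (new-∈-subdivide⁻ (y ∷ ys) q)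

  new-∈-subdivide⁺ : ∀ xs → Unique xs → Linked Adj xs →
                     v₀ ∈ₗ xs → v₁ ∈ₗ xs → zero ∈ₗ subdivide xs
  new-∈-subdivide⁺ (x ∷ [])     _  _ (here p) (here q) = ⊥-elim (v₀≢v₁ (trans p (sym q)))
  new-∈-subdivide⁺ (x ∷ y ∷ ys) un l p q with Edge? x y | p | q
  ... | yes _  | _          | _          = there (here refl)
  ... | no  _  | here refl  | here v₁≡  = ⊥-elim (v₀≢v₁ (sym v₁≡))
  ... | no ¬ex | here refl  | there v₁∈ = ⊥-elim (¬ex (inj₁ (refl , sym (next-on-path T₀ un l e v₁∈))))
  ... | no ¬ex | there v₀∈  | here refl =
    ⊥-elim (¬ex (inj₂ (refl , sym (next-on-path T₀ un l (Adj-sym v₀ v₁ e) v₀∈))))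
  ... | no  _  | there v₀∈  | there v₁∈ with un | l
  ... | _ ∷ un′ | _ ∷ l′ = there (new-∈-subdivide⁺ (y ∷ ys) un′ l′ v₀∈ v₁∈)

  subdivide-unique : ∀ xs → Unique xs → Unique (subdivide xs)
  subdivide-unique []           _               = []
  subdivide-unique (x ∷ [])     _               = [] ∷ []
  subdivide-unique (x ∷ y ∷ ys) un@(_ ∷ un′) with Edge? x y
  ... | yes ex = ¬Any⇒All¬ _ (λ { (here ()) ; (there p) → x∉ (∈-subdivide⁻ (y ∷ ys) p) })
               ∷ ¬Any⇒All¬ _ (x∉ ∘ End-∈ (proj₁ (Edge⇒End ex)) ∘ new-∈-subdivide⁻ (y ∷ ys))
               ∷ subdivide-unique (y ∷ ys) un′
    where
    x∉ : x ∉ₗ y ∷ ys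
    x∉ = Uniqueₚ.Unique[x∷xs]⇒x∉xs un
    End-∈ : ∀ {zs} → End x → v₀ ∈ₗ zs × v₁ ∈ₗ zs → x ∈ₗ zs
    End-∈ (inj₁ refl) = proj₁
    End-∈ (inj₂ refl) = proj₂
  ... | no _ = ¬Any⇒All¬ _ (Uniqueₚ.Unique[x∷xs]⇒x∉xs un ∘ ∈-subdivide⁻ (y ∷ ys))
             ∷ subdivide-unique (y ∷ ys) un′

  subdivide-linked : ∀ xs → Linked Adj xs → Linked Adj⁺ (subdivide xs)
  subdivide-linked []           _       = []
  subdivide-linked (x ∷ [])     _       = [-]
  subdivide-linked (x ∷ y ∷ ys) (a ∷ l) with Edge? x y
  ... | yes ex = proj₁ (Edge⇒End ex) ∷ proj₂ (Edge⇒End ex) ∷ subdivide-linked (y ∷ ys) l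
  ... | no ¬ex = (a , ¬ex) ∷ subdivide-linked (y ∷ ys) l

  subdivide-nonempty : ∀ xs → 1 ≤ length xs → 1 ≤ length (subdivide xs)
  subdivide-nonempty (_ ∷ _) _ = s≤s z≤n

  subdividePath : TPath T₀ → TPath subdivided
  subdividePath P = record
    { verts    = subdivide (verts P)
    ; nonempty = subdivide-nonempty (verts P) (nonempty P)
    ; unique   = subdivide-unique (verts P) (unique P)
    ; linked   = Linked.map to-adj⁺ (subdivide-linked (verts P) (linked P))
    }

  ⊆-subdividePath⁺ : ∀ {P Q} → P ⊆P Q → subdividePath P ⊆P subdividePath Q
  ⊆-subdividePath⁺ {P} {Q} P⊆Q zero p with new-∈-subdivide⁻ (verts P) p
  ... | v₀∈ , v₁∈ = new-∈-subdivide⁺ (verts Q) (unique Q) (linked Q) (P⊆Q v₀ v₀∈) (P⊆Q v₁ v₁∈)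
  ⊆-subdividePath⁺ {P} {Q} P⊆Q (suc v) p = ∈-subdivide⁺ (verts Q) (P⊆Q v (∈-subdivide⁻ (verts P) p))

  ⊆-subdividePath⁻ : ∀ {P Q} → subdividePath P ⊆P subdividePath Q → P ⊆P Q
  ⊆-subdividePath⁻ {P} {Q} P⊆Q v p = ∈-subdivide⁻ (verts Q) (P⊆Q (suc v) (∈-subdivide⁺ (verts P) p))

  ⊊-subdividePath : ∀ {P Q} → P ⊊P Q ⇔ subdividePath P ⊊P subdividePath Q
  ⊊-subdividePath {P} {Q} = mk⇔
    (λ (P⊆Q , w , w∈Q , w∉P) →
       ⊆-subdividePath⁺ {P} {Q} P⊆Q , suc w , ∈-subdivide⁺ (verts Q) w∈Q , w∉P ∘ ∈-subdivide⁻ (verts P))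
    (λ (P⊆Q , w , w∈Q , w∉P) → ⊆-subdividePath⁻ {P} {Q} P⊆Q , witness w w∈Q w∉P)
    where
    witness : ∀ w → w ∈ₗ subdivide (verts Q) → w ∉ₗ subdivide (verts P) → ∃[ v ] v ∈P Q × ¬ v ∈P P
    witness (suc w) w∈Q w∉P = w , ∈-subdivide⁻ (verts Q) w∈Q , w∉P ∘ ∈-subdivide⁺ (verts P)
    witness zero w∈Q w∉P
      with new-∈-subdivide⁻ (verts Q) w∈Q | any? (v₀ ≟_) (verts P) | any? (v₁ ≟_) (verts P)
    ... | _       | yes v₀∈P | yes v₁∈P =
      ⊥-elim (w∉P (new-∈-subdivide⁺ (verts P) (unique P) (linked P) v₀∈P v₁∈P))
    ... | v₀∈Q , _ | no v₀∉P | _        = v₀ , v₀∈Q , v₀∉P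
    ... | _ , v₁∈Q | yes _   | no v₁∉P  = v₁ , v₁∈Q , v₁∉P

  halfPath : TPath subdivided
  halfPath = record
    { verts    = suc v₀ ∷ zero ∷ []
    ; nonempty = s≤s z≤n
    ; unique   = ((λ ()) ∷ []) ∷ [] ∷ []
    ; linked   = to-adj⁺ {suc v₀} {zero} (inj₁ refl) ∷ [-]
    }

-- Modules and upper covers

subsetOf : ∀ {n} {P : Pred (Fin n) 0ℓ} → U.Decidable P → Subset n
subsetOf P? = tabulate (isYes ∘ P?)

∈-subsetOf : ∀ {n} {P : Pred (Fin n) 0ℓ} (P? : U.Decidable P) {x} → x ∈ subsetOf P? ⇔ P x
∈-subsetOf P? {x} = mk⇔
  (λ x∈ → toWitness (Equivalence.from T-≡ (trans (sym (lookup∘tabulate (isYes ∘ P?) x)) ([]=⇒lookup x∈))))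
  (λ Px → lookup⇒[]= x _ (trans (lookup∘tabulate (isYes ∘ P?) x) (Equivalence.to T-≡ (fromWitness Px))))

module _ {n : ℕ} {_<_ : Rel (Fin n) 0ℓ} {M : Subset n} (M-module : IsModule _<_ M)
         (M-chain : ∀ x y → x ∈ M → y ∈ M → Comparable _<_ x y) where

  comparable-clique : ∀ {y a b} → a ∈ M → b ∈ M → Comparable _<_ y a → Comparable _<_ y b
  comparable-clique {y} a∈M b∈M y~a with y ∈? M
  ... | yes y∈M = M-chain y _ y∈M b∈M
  ... | no  y∉M with M-module y y∉M
  ...   | inj₁ all  = all _ b∈M
  ...   | inj₂ none = ⊥-elim (none _ a∈M y~a)

module _ {n : ℕ} {_<_ : Rel (Fin n) 0ℓ} (<-trans : Transitive _<_) (_<?_ : Decidable _<_)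
         {P : Pred (Fin n) 0ℓ} (P? : U.Decidable P) (P-chain : ∀ {x y} → P x → P y → Comparable _<_ x y) where

  least-in : ∀ xs {c} → P c → ∃[ a ] P a × (∀ {x} → x ∈ₗ xs → P x → x ≡ a ⊎ a < x)
  least-in []       {c} Pc = c , Pc , λ ()
  least-in (x ∷ xs) Pc with least-in xs Pc | P? x
  ... | a , Pa , a-least | no ¬Px = a , Pa , λ { (here refl) Px → ⊥-elim (¬Px Px) ; (there p) → a-least p }
  ... | a , Pa , a-least | yes Px with x <? a
  ...   | yes x<a = x , Px , λ { (here refl) _ → inj₁ refl ; (there p) Py → above-x (a-least p Py) }
    where
    above-x : ∀ {y} → y ≡ a ⊎ a < y → y ≡ x ⊎ x < y
    above-x (inj₁ refl) = inj₂ x<a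
    above-x (inj₂ a<y)  = inj₂ (<-trans x<a a<y)
  ...   | no x≮a  = a , Pa , λ { (here refl) _ → above-a (P-chain Px Pa) ; (there p) → a-least p }
    where
    above-a : Comparable _<_ x a → x ≡ a ⊎ a < x
    above-a (inj₁ x≡a)        = inj₁ x≡a
    above-a (inj₂ (inj₁ x<a)) = ⊥-elim (x≮a x<a)
    above-a (inj₂ (inj₂ a<x)) = inj₂ a<x

  least : ∀ {c} → P c → ∃[ a ] P a × (∀ {x} → P x → x ≡ a ⊎ a < x)
  least Pc with least-in (allFin n) Pc
  ... | a , Pa , a-least = a , Pa , a-least (∈-allFin _)

module UpperCover {n : ℕ} {_<_ : Rel (Fin n) 0ℓ} (spo : IsStrictPartialOrder _≡_ _<_) (_<?_ : Decidable _<_)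
  {M : Subset n} (M-strong : IsStrongModule _<_ M) (M-chain : ∀ x y → x ∈ M → y ∈ M → Comparable _<_ x y)
  {z : Fin n} (z∈M : z ∈ M) (z-minimal : ∀ x → ¬ x < z) {c : Fin n} (c∈M : c ∈ M) (c≢z : c ≢ z) where

  open IsStrictPartialOrder spo using (irrefl) renaming (trans to <-trans)

  M-module : IsModule _<_ M
  M-module = proj₁ M-strong

  z<c : z < c
  z<c with M-chain c z c∈M z∈M
  ... | inj₁ c≡z        = ⊥-elim (c≢z c≡z)
  ... | inj₂ (inj₁ c<z) = ⊥-elim (z-minimal c c<z)
  ... | inj₂ (inj₂ z<c) = z<c

  private
    cover-in-M : ∃[ a ] (a ∈ M × z < a) × (∀ {x} → x ∈ M × z < x → x ≡ a ⊎ a < x)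
    cover-in-M = least <-trans _<?_ (λ x → (x ∈? M) ×-dec (z <? x))
      (λ (x∈M , _) (y∈M , _) → M-chain _ _ x∈M y∈M) (c∈M , z<c)

  a : Fin n
  a = proj₁ cover-in-M

  a∈M : a ∈ M
  a∈M = proj₁ (proj₁ (proj₂ cover-in-M))

  z<a : z < a
  z<a = proj₂ (proj₁ (proj₂ cover-in-M))

  a-least : ∀ {x} → x ∈ M → z < x → x ≡ a ⊎ a < x
  a-least x∈M z<x = proj₂ (proj₂ cover-in-M) (x∈M , z<x)

  comparable-a⇒z : ∀ {y} → Comparable _<_ y a → Comparable _<_ y z
  comparable-a⇒z = comparable-clique M-module M-chain a∈M z∈M

  Interval : Pred (Fin n) 0ℓ
  Interval y = y ≡ z ⊎ (z < y × y < a)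

  I : Subset n
  I = subsetOf (λ y → (y ≟ z) ⊎-dec ((z <? y) ×-dec (y <? a)))

  ∈I⁺ : ∀ {y} → Interval y → y ∈ I
  ∈I⁺ = Equivalence.from (∈-subsetOf _)

  ∈I⁻ : ∀ {y} → y ∈ I → Interval y
  ∈I⁻ = Equivalence.to (∈-subsetOf _)

  I-module : IsModule _<_ I
  I-module w w∉I with z <? w
  ... | yes z<w = inj₁ λ x x∈I → below-w (∈I⁻ x∈I)
    where
    a≼w : w ≡ a ⊎ a < w
    a≼w with comparable-clique M-module M-chain z∈M a∈M (inj₂ (inj₂ z<w))
    ... | inj₁ w≡a        = inj₁ w≡a
    ... | inj₂ (inj₁ w<a) = ⊥-elim (w∉I (∈I⁺ (inj₂ (z<w , w<a))))
    ... | inj₂ (inj₂ a<w) = inj₂ a<w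
    below-w : ∀ {x} → Interval x → Comparable _<_ w x
    below-w (inj₁ refl) = inj₂ (inj₂ z<w)
    below-w (inj₂ (_ , x<a)) with a≼w
    ... | inj₁ refl = inj₂ (inj₂ x<a)
    ... | inj₂ a<w  = inj₂ (inj₂ (<-trans x<a a<w))
  ... | no z≮w = inj₂ λ x x∈I → incomparable (∈I⁻ x∈I)
    where
    w≁z : ¬ Comparable _<_ w z
    w≁z (inj₁ refl)       = w∉I (∈I⁺ (inj₁ refl))
    w≁z (inj₂ (inj₁ w<z)) = z-minimal w w<z
    w≁z (inj₂ (inj₂ z<w)) = z≮w z<w
    incomparable : ∀ {x} → Interval x → ¬ Comparable _<_ w x
    incomparable (inj₁ refl)                         = w≁z
    incomparable (inj₂ x∈)         (inj₁ refl)        = w∉I (∈I⁺ (inj₂ x∈))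
    incomparable (inj₂ (_ , x<a)) (inj₂ (inj₁ w<x)) = w≁z (comparable-a⇒z (inj₂ (inj₁ (<-trans w<x x<a))))
    incomparable (inj₂ (z<x , _)) (inj₂ (inj₂ x<w)) = z≮w (<-trans z<x x<w)

  nothing-between : ∀ {y} → z < y → ¬ y < a
  nothing-between {y} z<y y<a with proj₂ M-strong I I-module
  ... | inj₁ disjoint = disjoint z z∈M (∈I⁺ (inj₁ refl))
  ... | inj₂ (inj₁ M⊆I) with ∈I⁻ (M⊆I a∈M)
  ...   | inj₁ a≡z       = irrefl (sym a≡z) z<a
  ...   | inj₂ (_ , a<a) = irrefl refl a<a
  nothing-between {y} z<y y<a | inj₂ (inj₂ I⊆M) with a-least (I⊆M (∈I⁺ (inj₂ (z<y , y<a)))) z<y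
  ...   | inj₁ refl = irrefl refl y<a
  ...   | inj₂ a<y  = irrefl refl (<-trans a<y y<a)

  a-covers-z : ∀ {y} → z < y → y ≡ a ⊎ a < y
  a-covers-z z<y with comparable-clique M-module M-chain z∈M a∈M (inj₂ (inj₂ z<y))
  ... | inj₁ y≡a        = inj₁ y≡a
  ... | inj₂ (inj₁ y<a) = ⊥-elim (nothing-between z<y y<a)
  ... | inj₂ (inj₂ a<y) = inj₂ a<y

-- The subdivided representation

module SubdividedRepresentation {n : ℕ} {_<_ : Rel (Fin n) 0ℓ} (spo : IsStrictPartialOrder _≡_ _<_)
  (R : CPTRep (Fin n) _<_) {z a : Fin n} (z-trivial : Trivial (CPTRep.W R z)) (z<a : z < a)
  (a-covers-z : ∀ {y} → z < y → y ≡ a ⊎ a < y)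
  (comparable-a⇒z : ∀ {y} → Comparable _<_ y a → Comparable _<_ y z) where

  open CPTRep R
  open TPath
  open IsStrictPartialOrder spo using (irrefl)
  open Equivalence

  v₀ : Fin m
  v₀ = proj₁ (trivial-verts {P = W z} z-trivial)

  Wz≡[v₀] : verts (W z) ≡ [ v₀ ]
  Wz≡[v₀] = proj₂ (trivial-verts {P = W z} z-trivial)

  z-minimal : ∀ x → ¬ x < z
  z-minimal = trivial-minimal R z-trivial

  v₀∈Wz : v₀ ∈P W z
  v₀∈Wz = subst (v₀ ∈ₗ_) (sym Wz≡[v₀]) (here refl)

  Wz⊊Wa : W z ⊊P W a
  Wz⊊Wa = to (rep z a) z<a

  v₀∈Wa : v₀ ∈P W a
  v₀∈Wa = proj₁ Wz⊊Wa v₀ v₀∈Wz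

  private
    neighbour : ∃[ v₁ ] Tree.Adj tree v₀ v₁ × v₁ ∈P W a
    neighbour = neighbour-on-path tree (linked (W a)) (⊊P⇒NonTrivial {P = W z} {Q = W a} Wz⊊Wa) v₀∈Wa

  v₁ : Fin m
  v₁ = proj₁ neighbour

  e : Tree.Adj tree v₀ v₁
  e = proj₁ (proj₂ neighbour)

  v₁∈Wa : v₁ ∈P W a
  v₁∈Wa = proj₂ (proj₂ neighbour)

  open Subdivision tree e

  Wa⊆Wy : ∀ {y} → z < y → W a ⊆P W y
  Wa⊆Wy z<y with a-covers-z z<y
  ... | inj₁ refl = λ _ v∈ → v∈
  ... | inj₂ a<y  = proj₁ (to (rep a _) a<y)

  Wx⊈Wz : ∀ {x} → x ≢ z → ¬ W x ⊆P W z
  Wx⊈Wz {x} x≢z Wx⊆Wz with comparable-a⇒z (inj₂ (inj₁ x<a))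
    where
    x<a : x < a
    x<a = from (rep x a) (⊆P-⊊P-trans {P = W x} {Q = W z} {R = W a} Wx⊆Wz Wz⊊Wa)
  ... | inj₁ x≡z        = x≢z x≡z
  ... | inj₂ (inj₁ x<z) = z-minimal x x<z
  ... | inj₂ (inj₂ z<x) = ⊊P⇒⊉P {P = W z} {Q = W x} (to (rep z x) z<x) Wx⊆Wz

  halfPath-⊊ : ∀ {y} → z < y ⇔ halfPath ⊊P subdividePath (W y)
  halfPath-⊊ {y} = mk⇔ to′ from′
    where
    to′ : z < y → halfPath ⊊P subdividePath (W y)
    to′ z<y = half⊆ , suc v₁ , ∈-subdivide⁺ (verts (W y)) (Wa⊆Wy z<y v₁ v₁∈Wa) , v₁∉half
      where
      half⊆ : halfPath ⊆P subdividePath (W y)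
      half⊆ _ (here refl)         = ∈-subdivide⁺ (verts (W y)) (Wa⊆Wy z<y v₀ v₀∈Wa)
      half⊆ _ (there (here refl)) = new-∈-subdivide⁺ (verts (W y)) (unique (W y)) (linked (W y))
                                      (Wa⊆Wy z<y v₀ v₀∈Wa) (Wa⊆Wy z<y v₁ v₁∈Wa)
      v₁∉half : ¬ suc v₁ ∈P halfPath
      v₁∉half (here eq)         = v₀≢v₁ (sym (suc-injective eq))
      v₁∉half (there (here ()))
    from′ : halfPath ⊊P subdividePath (W y) → z < y
    from′ (half⊆ , _) = from (rep z y) (singleton-⊊P {P = W z} {Q = W y} Wz≡[v₀]
      (∈-subdivide⁻ (verts (W y)) (half⊆ (suc v₀) (here refl)))
      (proj₂ (new-∈-subdivide⁻ (verts (W y)) (half⊆ zero (there (here refl)))))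
      (v₀≢v₁ ∘ sym))

  ⊄halfPath : ∀ {x} → x ≢ z → ¬ subdividePath (W x) ⊊P halfPath
  ⊄halfPath {x} x≢z (⊆half , _) = Wx⊈Wz x≢z λ w w∈Wx →
    subst (_∈P W z) (sym (suc∈half⇒v₀ (⊆half (suc w) (∈-subdivide⁺ (verts (W x)) w∈Wx)))) v₀∈Wz
    where
    suc∈half⇒v₀ : ∀ {w} → suc w ∈P halfPath → w ≡ v₀
    suc∈half⇒v₀ (here eq) = suc-injective eq
    suc∈half⇒v₀ (there (here ()))

  pathOf : ∀ x → Dec (x ≡ z) → TPath subdivided
  pathOf x (yes _) = halfPath
  pathOf x (no  _) = subdividePath (W x)

  W⁺ : Fin n → TPath subdivided
  W⁺ x = pathOf x (x ≟ z)

  rep⁺ : ∀ x y → (x < y) ⇔ (W⁺ x ⊊P W⁺ y)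
  rep⁺ x y with x ≟ z | y ≟ z
  ... | yes refl | yes refl = mk⇔ (⊥-elim ∘ irrefl refl) λ (_ , _ , w∈ , w∉) → ⊥-elim (w∉ w∈)
  ... | yes refl | no  _    = halfPath-⊊
  ... | no  x≢z  | yes refl = mk⇔ (⊥-elim ∘ z-minimal x) (⊥-elim ∘ ⊄halfPath x≢z)
  ... | no  _    | no  _    = ⇔.trans (rep x y) (⊊-subdividePath {W x} {W y})

  representation : CPTRep (Fin n) _<_
  representation = record { tree = subdivided ; W = W⁺ ; rep = rep⁺ }

  z-nonTrivial : NonTrivial (W⁺ z)
  z-nonTrivial with z ≟ z
  ... | yes _   = s≤s (s≤s z≤n)
  ... | no  z≢z = ⊥-elim (z≢z refl)

nonTrivial-representation :
  ∀ {n} {_<_ : Rel (Fin n) 0ℓ} → IsStrictPartialOrder _≡_ _<_ → Decidable _<_ →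
  ∀ {M} → IsStrongModule _<_ M → (∀ x y → x ∈ M → y ∈ M → Comparable _<_ x y) →
  ∀ {z c} → z ∈ M → c ∈ M → c ≢ z →
  (R : CPTRep (Fin n) _<_) → Trivial (CPTRep.W R z) →
  Σ (CPTRep (Fin n) _<_) (λ R′ → NonTrivial (CPTRep.W R′ z))
nonTrivial-representation spo _<?_ M-strong M-chain z∈M c∈M c≢z R z-trivial = representation , z-nonTrivial
  where
  open UpperCover spo _<?_ M-strong M-chain z∈M (trivial-minimal R z-trivial) c∈M c≢z
  open SubdividedRepresentation spo R z-trivial z<a a-covers-z comparable-a⇒z

lemma6 : ∀ {n : ℕ} (_<_ : Rel (Fin n) 0ℓ) → IsStrictPartialOrder _≡_ _<_ → Decidable _<_ →
         DuallyCPT (Fin n) _<_ →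
         (M : Subset n) → IsStrongModule _<_ M → IsCliqueModule _<_ M →
         CI (Sub _<_ M) (restrict _<_ M) →
         (z : Fin n) → z ∈ M →
         (R : CPTRep (Fin n) _<_) → Trivial (CPTRep.W R z) →
         Σ (CPTRep (Fin n) _<_) (λ R' → NonTrivial (CPTRep.W R' z))
lemma6 _<_ spo _<?_ _ M M-strong (_ , (x , y , x∈M , y∈M , x≢y) , _ , M-chain) _ z z∈M R z-trivial with x ≟ z
... | yes refl = nonTrivial-representation spo _<?_ M-strong M-chain z∈M y∈M (x≢y ∘ sym) R z-trivial
... | no  x≢z  = nonTrivial-representation spo _<?_ M-strong M-chain z∈M x∈M x≢z R z-trivial
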